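{- Let $(\mathbf{A},\mathbf{B})$ be a promise template over finite domains and suppose there is a minion homomorphism from $\mathcal{M}_{\mathrm{BLP+Aff}}$ to $\mathcal{N}=\operatorname{Pol}(\mathbf{A},\mathbf{B})$. Then for every $L\in\mathbb{N}$, $\mathcal{N}$ contains a block-symmetric polymorphism of arity $2L+1$ with two blocks of sizes $L$ and $L+1$.
   Context: A relational structure $\mathbf{A}$ over signature $\tau$ has finite domain $A$ and relations $R^{\mathbf{A}}\subseteq A^{\operatorname{ar}(R)}$; a promise template $(\mathbf{A},\mathbf{B})$ is a pair of structures of the same signature with a homomorphism (relation-preserving map) $\mathbf{A}\to\mathbf{B}$. A polymorphism of arity $L$ is $f:A^L\to B$ such that for every $R\in\tau$ and $x^{(1)},\dots,x^{(L)}\in R^{\mathbf{A}}$, $(f(x^{(1)}_t,\dots,x^{(L)}_t))_{t=1}^{\operatorname{ar}(R)}\in R^{\mathbf{B}}$. $f$ is block-symmetric with blocks $[L]=B_1\cup\dots\cup B_k$ (a partition) if $f$ is invariant under every permutation of coordinates mapping each block to itself. A minion $\mathcal{M}$ consists of sets $\mathcal{M}^{(L)}$, $L\in\mathbb{N}$, and maps $(\cdot)_{/\pi}:\mathcal{M}^{(L)}\to\mathcal{M}^{(L')}$ for each $\pi:[L]\to[L']$, with $(f_{/\pi})_{/\tau}=f_{/\tau\circ\pi}$ and $f_{/\mathrm{id}}=f$. A minion homomorphism $\xi:\mathcal{M}\to\mathcal{N}$ maps $\mathcal{M}^{(L)}$ to $\mathcal{N}^{(L)}$ and satisfies $\xi(f_{/\pi})=\xi(f)_{/\pi}$.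 $\operatorname{Pol}(\mathbf{A},\mathbf{B})$ is the minion of polymorphisms with $f_{/\pi}(x_1,\dots,x_{L'}):=f(x_{\pi(1)},\dots,x_{\pi(L)})$. The minion $\mathcal{M}_{\mathrm{BLP+Aff}}$ has $L$-ary elements the pairs $(w,r)$ with $w:[L]\to\mathbb{Q}_{\ge0}$, $\sum_i w(i)=1$, $r:[L]\to\mathbb{Z}$, $\sum_i r(i)=1$, and $w(i)=0\Rightarrow r(i)=0$; for $\pi:[L]\to[L']$, $(w,r)_{/\pi}=(w',r')$ with $w'(i)=\sum_{j\in\pi^{ -1}(i)}w(j)$, $r'(i)=\sum_{j\in\pi^{ -1}(i)}r(j)$. -}

module Defs where

open import Data.Nat using (ℕ; suc; _+_)
open import Data.Fin using (Fin; _≟_)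
open import Data.Fin.Subset using (Subset; ∣_∣)
open import Data.Fin.Permutation using (Permutation′; _⟨$⟩ʳ_)
open import Data.Vec using (Vec; lookup; tabulate; foldr; allFin)
open import Data.Bool using (if_then_else_)
open import Data.Product using (Σ; _×_; _,_; proj₁; ∃; ∃-syntax)
open import Data.Integer using (ℤ) renaming (_+_ to _+ℤ_; 0ℤ to 0ℤ; 1ℤ to 1ℤ)
open import Data.Rational using (ℚ; 0ℚ; 1ℚ) renaming (_+_ to _+ℚ_; _≤_ to _≤ℚ_)
open import Relation.Nullary.Decidable using (⌊_⌋)
open import Relation.Binary.PropositionalEquality using (_≡_)
open import Function using (_∘_)

record Signature : Set₁ where
  field
    nsym : ℕ
    ar   : Fin nsym → ℕ
open Signature public

record Structure (τ : Signature) : Set₁ where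
  field
    size : ℕ
    rel  : (R : Fin (nsym τ)) → (Fin (ar τ R) → Fin size) → Set
open Structure public

IsHom : {τ : Signature} (A B : Structure τ) → (Fin (size A) → Fin (size B)) → Set
IsHom {τ} A B h = (R : Fin (nsym τ)) (x : Fin (ar τ R) → Fin (size A)) →
  rel A R x → rel B R (h ∘ x)

PromiseTemplate : {τ : Signature} (A B : Structure τ) → Set
PromiseTemplate A B = ∃[ h ] IsHom A B h

IsPolymorphism : {τ : Signature} (A B : Structure τ) (L : ℕ) →
  ((Fin L → Fin (size A)) → Fin (size B)) → Set
IsPolymorphism {τ} A B L f =
  (R : Fin (nsym τ)) (x : Fin L → Fin (ar τ R) → Fin (size A)) →
  ((i : Fin L) → rel A R (x i)) →
  rel B R (λ t → f (λ i → x i t))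

Pol : {τ : Signature} (A B : Structure τ) (L : ℕ) → Set
Pol A B L = Σ ((Fin L → Fin (size A)) → Fin (size B)) (IsPolymorphism A B L)

minorFun : {X Y : Set} {L L' : ℕ} → (Fin L → Fin L') →
  ((Fin L → X) → Y) → ((Fin L' → X) → Y)
minorFun π f y = f (y ∘ π)

sumℚ : {n : ℕ} → Vec ℚ n → ℚ
sumℚ = foldr _ _+ℚ_ 0ℚ

sumℤ : {n : ℕ} → Vec ℤ n → ℤ
sumℤ = foldr _ _+ℤ_ 0ℤ

record BLPAff (L : ℕ) : Set where
  constructor mkBLPAff
  field
    w      : Vec ℚ L
    r      : Vec ℤ L
    w-nonneg : (i : Fin L) → 0ℚ ≤ℚ lookup w i
    w-sum  : sumℚ w ≡ 1ℚ
    r-sum  : sumℤ r ≡ 1ℤ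
    supp   : (i : Fin L) → lookup w i ≡ 0ℚ → lookup r i ≡ 0ℤ
open BLPAff public

pushℚ : {L L' : ℕ} → (Fin L → Fin L') → Vec ℚ L → Vec ℚ L'
pushℚ π w = tabulate λ i → sumℚ (tabulate λ j → if ⌊ π j ≟ i ⌋ then lookup w j else 0ℚ)

pushℤ : {L L' : ℕ} → (Fin L → Fin L') → Vec ℤ L → Vec ℤ L'
pushℤ π r = tabulate λ i → sumℤ (tabulate λ j → if ⌊ π j ≟ i ⌋ then lookup r j else 0ℤ)

-- The minor operation of M_BLP+Aff is given on the data (w , r); the
-- proof fields are carried along. A minion homomorphism is required to
-- commute with minors on the data (w , r): we quantify over any element
-- of BLPAff L' whose data equals the pushed-forward data.
IsMinorBLPAff : {L L' : ℕ} → (Fin L → Fin L') → BLPAff L → BLPAff L' → Set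
IsMinorBLPAff π m m' = (w m' ≡ pushℚ π (w m)) × (r m' ≡ pushℤ π (r m))

MinionHom : {τ : Signature} (A B : Structure τ) → Set
MinionHom A B =
  Σ ((L : ℕ) → BLPAff L → Pol A B L) λ ξ →
    {L L' : ℕ} (π : Fin L → Fin L') (m : BLPAff L) (m' : BLPAff L') →
    IsMinorBLPAff π m m' →
    (y : Fin L' → Fin (size A)) →
    proj₁ (ξ L' m') y ≡ minorFun π (proj₁ (ξ L m)) y

IsBlockSymmetric2 : {X Y : Set} {n : ℕ} → Subset n → ((Fin n → X) → Y) → Set
IsBlockSymmetric2 {X} {Y} {n} p f =
  (σ : Permutation′ n) →
  ((i : Fin n) → lookup p (σ ⟨$⟩ʳ i) ≡ lookup p i) →
  (x : Fin n → X) → f (λ i → x (σ ⟨$⟩ʳ i)) ≡ f x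

-- The element of M_BLP+Aff of arity L + (L + 1) with uniform weights and
-- affine part −1 on the first block and +1 on the second (summing to
-- −L + (L + 1) = 1) is its own minor along every block-preserving permutation
-- of coordinates. A minion homomorphism commutes with minors, so the image of
-- this element is invariant under those permutations.
module Submission where

open import Defs
open import Data.Nat using (ℕ; zero; suc; _+_; NonZero; ≢-nonZero)
open import Data.Nat.Properties using (m+1+n≢0)
open import Data.Fin using (Fin; _≟_) renaming (zero to 0F; suc to sucF)
open import Data.Fin.Properties using (suc-injective; 0≢1+n)
open import Data.Fin.Subset using (Subset; ∣_∣; ∁; ⊤; ⊥)
open import Data.Fin.Permutation using (Permutation′; _⟨$⟩ʳ_; _⟨$⟩ˡ_; inverseʳ)
open import Data.Vec using (Vec; lookup; tabulate; foldr; replicate; map; _++_)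
open import Data.Vec.Properties using (lookup-map; lookup-replicate; tabulate∘lookup; tabulate-cong)
open import Data.Bool using (Bool; true; false; if_then_else_)
open import Data.Product using (Σ; _×_; _,_; ∃-syntax; proj₁)
open import Data.Empty using (⊥-elim)
open import Data.Integer using (ℤ; +_; _-_; -1ℤ; 1ℤ) renaming (_+_ to _+ℤ_)
import Data.Integer.Properties as ℤ
open import Data.Integer.Tactic.RingSolver using (solve-∀)
open import Data.Rational using (ℚ; 0ℚ; 1ℚ; 1/_; Positive; NonNegative; _<_) renaming (NonZero to NonZeroℚ; _+_ to _+ℚ_; _*_ to _*ℚ_)
import Data.Rational.Properties as ℚ
open import Function using (_∘_)
open import Function.Bundles using (Injection)
open import Function.Definitions using (Injective)
open import Function.Properties.Inverse using (↔⇒↣)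
open import Relation.Nullary using (yes; no)
open import Relation.Nullary.Decidable using (⌊_⌋)
open import Relation.Binary.PropositionalEquality using (_≡_; _≢_; refl; sym; trans; cong; subst; module ≡-Reasoning)

Fixes : {X : Set} {n : ℕ} → Permutation′ n → Vec X n → Set
Fixes σ v = ∀ i → lookup v (σ ⟨$⟩ʳ i) ≡ lookup v i

module FibreSum {X : Set} (_∙_ : X → X → X) (ε : X)
  (identityˡ : ∀ x → ε ∙ x ≡ x) (identityʳ : ∀ x → x ∙ ε ≡ x) where

  sum : ∀ {n} → Vec X n → X
  sum = foldr _ _∙_ ε

  fibre : ∀ {n m} → (Fin n → Fin m) → (Fin n → X) → Fin m → X
  fibre π f i = sum (tabulate λ j → if ⌊ π j ≟ i ⌋ then f j else ε)

  push : ∀ {n m} → (Fin n → Fin m) → Vec X n → Vec X m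
  push π v = tabulate (fibre π (lookup v))

  fibre-empty : ∀ {n m} (π : Fin n → Fin m) (f : Fin n → X) {i} →
    (∀ j → π j ≢ i) → fibre π f i ≡ ε
  fibre-empty {zero}  π f h = refl
  fibre-empty {suc n} π f {i} h with π 0F ≟ i
  ... | yes π0≡i = ⊥-elim (h 0F π0≡i)
  ... | no _     = trans (identityˡ _) (fibre-empty (π ∘ sucF) (f ∘ sucF) (h ∘ sucF))

  fibre-singleton : ∀ {n m} {π : Fin n → Fin m} → Injective _≡_ _≡_ π →
    (f : Fin n → X) {i : Fin m} {j : Fin n} → π j ≡ i → fibre π f i ≡ f j
  fibre-singleton {suc n} {π = π} π-inj f {i} {j} πj≡i with π 0F ≟ i | j
  ... | yes _    | 0F     = trans (cong (f 0F ∙_) (fibre-empty (π ∘ sucF) (f ∘ sucF)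
                              λ k πk≡i → 0≢1+n (π-inj (trans πj≡i (sym πk≡i)))))
                              (identityʳ (f 0F))
  ... | yes π0≡i | sucF k = ⊥-elim (0≢1+n (π-inj (trans π0≡i (sym πj≡i))))
  ... | no π0≢i  | 0F     = ⊥-elim (π0≢i πj≡i)
  ... | no _     | sucF k = trans (identityˡ _)
                              (fibre-singleton (suc-injective ∘ π-inj) (f ∘ sucF) πj≡i)

  push-fixed : ∀ {n} (σ : Permutation′ n) (v : Vec X n) → Fixes σ v → push (σ ⟨$⟩ʳ_) v ≡ v
  push-fixed σ v fixed = begin
    tabulate (fibre (σ ⟨$⟩ʳ_) (lookup v))  ≡⟨ tabulate-cong fibre≡ ⟩
    tabulate (lookup v)                    ≡⟨ tabulate∘lookup v ⟩
    v                                      ∎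
    where
    open ≡-Reasoning
    fibre≡ : ∀ i → fibre (σ ⟨$⟩ʳ_) (lookup v) i ≡ lookup v i
    fibre≡ i = begin
      fibre (σ ⟨$⟩ʳ_) (lookup v) i  ≡⟨ fibre-singleton (Injection.injective (↔⇒↣ σ)) (lookup v) (inverseʳ σ) ⟩
      lookup v (σ ⟨$⟩ˡ i)           ≡⟨ fixed (σ ⟨$⟩ˡ i) ⟨
      lookup v (σ ⟨$⟩ʳ (σ ⟨$⟩ˡ i))  ≡⟨ cong (lookup v) (inverseʳ σ) ⟩
      lookup v i                    ∎

-- Defs' pushℚ and pushℤ are definitionally FibreSumℚ.push and FibreSumℤ.push.
module FibreSumℚ = FibreSum _+ℚ_ 0ℚ ℚ.+-identityˡ ℚ.+-identityʳ
module FibreSumℤ = FibreSum _+ℤ_ (+ 0) ℤ.+-identityˡ ℤ.+-identityʳ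

fixes-replicate : {X : Set} {n : ℕ} (σ : Permutation′ n) (x : X) → Fixes σ (replicate n x)
fixes-replicate σ x i = trans (lookup-replicate (σ ⟨$⟩ʳ i) x) (sym (lookup-replicate i x))

fixes-map : {X Y : Set} {n : ℕ} (f : X → Y) (σ : Permutation′ n) {v : Vec X n} →
  Fixes σ v → Fixes σ (map f v)
fixes-map f σ {v} fixed i = begin
  lookup (map f v) (σ ⟨$⟩ʳ i)  ≡⟨ lookup-map (σ ⟨$⟩ʳ i) f v ⟩
  f (lookup v (σ ⟨$⟩ʳ i))      ≡⟨ cong f (fixed i) ⟩
  f (lookup v i)               ≡⟨ lookup-map i f v ⟨
  lookup (map f v) i           ∎
  where open ≡-Reasoning

minionHom-fixed : {τ : Signature} (A B : Structure τ) (ξ : MinionHom A B) {n : ℕ}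
  (m : BLPAff n) (σ : Permutation′ n) → Fixes σ (w m) → Fixes σ (r m) →
  (x : Fin n → Fin (size A)) → proj₁ (proj₁ ξ n m) (λ i → x (σ ⟨$⟩ʳ i)) ≡ proj₁ (proj₁ ξ n m) x
minionHom-fixed A B (_ , commutes) m σ w-fixed r-fixed x =
  sym (commutes (σ ⟨$⟩ʳ_) m m
    (sym (FibreSumℚ.push-fixed σ (w m) w-fixed) , sym (FibreSumℤ.push-fixed σ (r m) r-fixed)) x)

blocks : (a b : ℕ) → Subset (a + b)
blocks a b = ⊤ {n = a} ++ ⊥ {n = b}

∣blocks∣ : ∀ a b → ∣ blocks a b ∣ ≡ a
∣blocks∣ zero    zero    = refl
∣blocks∣ zero    (suc b) = ∣blocks∣ zero b
∣blocks∣ (suc a) b       = cong suc (∣blocks∣ a b)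

∣∁blocks∣ : ∀ a b → ∣ ∁ (blocks a b) ∣ ≡ b
∣∁blocks∣ zero    zero    = refl
∣∁blocks∣ zero    (suc b) = cong suc (∣∁blocks∣ zero b)
∣∁blocks∣ (suc a) b       = ∣∁blocks∣ a b

sign : Bool → ℤ
sign true  = -1ℤ
sign false = 1ℤ

sumℤ-sign-blocks : ∀ a b → sumℤ (map sign (blocks a b)) ≡ + b - + a
sumℤ-sign-blocks zero    zero    = refl
sumℤ-sign-blocks zero    (suc b) = begin
  1ℤ +ℤ sumℤ (map sign (blocks zero b))  ≡⟨ cong (1ℤ +ℤ_) (sumℤ-sign-blocks zero b) ⟩
  1ℤ +ℤ (+ b - + 0)                      ≡⟨ +-assoc-sub 1ℤ (+ b) (+ 0) ⟩
  (1ℤ +ℤ + b) - + 0                      ≡⟨ cong (_- + 0) (ℤ.pos-+ 1 b) ⟨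
  + suc b - + 0                          ∎
  where
  open ≡-Reasoning
  +-assoc-sub : ∀ x y z → x +ℤ (y - z) ≡ (x +ℤ y) - z
  +-assoc-sub = solve-∀
sumℤ-sign-blocks (suc a) b       = begin
  -1ℤ +ℤ sumℤ (map sign (blocks a b))  ≡⟨ cong (-1ℤ +ℤ_) (sumℤ-sign-blocks a b) ⟩
  -1ℤ +ℤ (+ b - + a)                   ≡⟨ -1+sub (+ a) (+ b) ⟩
  + b - (1ℤ +ℤ + a)                    ≡⟨ cong (+ b -_) (ℤ.pos-+ 1 a) ⟨
  + b - + suc a                        ∎
  where
  open ≡-Reasoning
  -1+sub : ∀ x y → -1ℤ +ℤ (y - x) ≡ y - (1ℤ +ℤ x)
  -1+sub = solve-∀

ℕ→ℚ : ℕ → ℚ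
ℕ→ℚ n = sumℚ (replicate n 1ℚ)

ℕ→ℚ-nonNeg : ∀ n → NonNegative (ℕ→ℚ n)
ℕ→ℚ-nonNeg zero    = _
ℕ→ℚ-nonNeg (suc n) = ℚ.nonNeg+nonNeg⇒nonNeg 1ℚ (ℕ→ℚ n) {{ℕ→ℚ-nonNeg n}}

ℕ→ℚ-pos : ∀ n .{{_ : NonZero n}} → Positive (ℕ→ℚ n)
ℕ→ℚ-pos (suc n) = ℚ.pos+nonNeg⇒pos 1ℚ (ℕ→ℚ n) {{ℕ→ℚ-nonNeg n}}

sumℚ-replicate : ∀ n x → sumℚ (replicate n x) ≡ ℕ→ℚ n *ℚ x
sumℚ-replicate zero    x = sym (ℚ.*-zeroˡ x)
sumℚ-replicate (suc n) x = begin
  x +ℚ sumℚ (replicate n x)    ≡⟨ cong (x +ℚ_) (sumℚ-replicate n x) ⟩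
  x +ℚ ℕ→ℚ n *ℚ x              ≡⟨ cong (_+ℚ ℕ→ℚ n *ℚ x) (ℚ.*-identityˡ x) ⟨
  1ℚ *ℚ x +ℚ ℕ→ℚ n *ℚ x        ≡⟨ ℚ.*-distribʳ-+ x 1ℚ (ℕ→ℚ n) ⟨
  (1ℚ +ℚ ℕ→ℚ n) *ℚ x           ∎
  where open ≡-Reasoning

module Uniform (n : ℕ) .{{_ : NonZero n}} where

  private instance
    n-pos : Positive (ℕ→ℚ n)
    n-pos = ℕ→ℚ-pos n
    n-nonZero : NonZeroℚ (ℕ→ℚ n)
    n-nonZero = ℚ.pos⇒nonZero (ℕ→ℚ n)

  uniform : Vec ℚ n
  uniform = replicate n (1/ ℕ→ℚ n)

  lookup-uniform-pos : ∀ i → 0ℚ < lookup uniform i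
  lookup-uniform-pos i = subst (0ℚ <_) (sym (lookup-replicate i _))
    (ℚ.positive⁻¹ (1/ ℕ→ℚ n) {{ℚ.1/pos⇒pos (ℕ→ℚ n)}})

  sumℚ-uniform : sumℚ uniform ≡ 1ℚ
  sumℚ-uniform = trans (sumℚ-replicate n (1/ ℕ→ℚ n)) (ℚ.*-inverseʳ (ℕ→ℚ n))

open Uniform

balanced : (L : ℕ) → BLPAff (L + suc L)
balanced L = mkBLPAff (uniform n) (map sign (blocks L (suc L)))
  (λ i → ℚ.<⇒≤ (lookup-uniform-pos n i))
  (sumℚ-uniform n)
  sign-sum
  (λ i wᵢ≡0 → ⊥-elim (ℚ.<-irrefl (sym wᵢ≡0) (lookup-uniform-pos n i)))
  where
  n = L + suc L
  instance
    n-nonZero : NonZero n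
    n-nonZero = ≢-nonZero (m+1+n≢0 L)
  sign-sum : sumℤ (map sign (blocks L (suc L))) ≡ 1ℤ
  sign-sum = trans (sumℤ-sign-blocks L (suc L)) (1+x-x (+ L))
    where
    1+x-x : ∀ x → (1ℤ +ℤ x) - x ≡ 1ℤ
    1+x-x = solve-∀

lemma5p5 : (τ : Signature) (A B : Structure τ) → PromiseTemplate A B →
    MinionHom A B →
    (L : ℕ) →
    ∃[ p ] ((∣ p ∣ ≡ L) × (∣ ∁ p ∣ ≡ suc L) ×
      Σ (Pol A B (L + suc L)) λ f → IsBlockSymmetric2 p (proj₁ f))
lemma5p5 τ A B _ ξ L =
  blocks L (suc L) , ∣blocks∣ L (suc L) , ∣∁blocks∣ L (suc L) ,
  proj₁ ξ _ (balanced L) ,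
  λ σ σ-fixes-blocks → minionHom-fixed A B ξ (balanced L) σ
    (fixes-replicate σ _) (fixes-map sign σ {blocks L (suc L)} σ-fixes-blocks)
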